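{- Let $G$ be a graph on $n\geq4$ vertices with minimum degree $\delta(G)\geq n/2+1$. Then, for any two pairs of distinct vertices $A=\{u,v\}$ and $B=\{w,x\}$ with $A\cap B=\varnothing$, $G$ contains two vertex-disjoint $(A,B)$-paths $P$ and $Q$ such that $V(P)\cup V(Q)=V(G)$.
   Context: An $(A,B)$-path is a path with one endpoint in $A$ and the other endpoint in $B$. -}

module Defs where

open import Data.Nat using (ℕ; _+_; _*_; _≤_)
open import Data.Fin using (Fin)
open import Data.List using (List; []; _∷_; _++_; length; filter; allFin)
open import Data.List.Relation.Unary.Linked using (Linked)
open import Data.List.Relation.Unary.Unique.Propositional using (Unique)
open import Data.List.Membership.Propositional using (_∈_; _∉_)
open import Data.Product using (Σ; ∃; _×_)
open import Data.Sum using (_⊎_)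
open import Data.Empty using (⊥)
open import Relation.Nullary using (¬_)
open import Relation.Binary using (Rel; Decidable)
open import Relation.Binary.PropositionalEquality using (_≡_)

record Graph (n : ℕ) : Set₁ where
  field
    Adj   : Rel (Fin n) _
    adj?  : Decidable Adj
    irrefl : ∀ {x} → ¬ Adj x x
    sym   : ∀ {x y} → Adj x y → Adj y x

open Graph public

degree : ∀ {n} (G : Graph n) → Fin n → ℕ
degree G v = length (filter (adj? G v) (allFin _))

IsPath : ∀ {n} → Graph n → List (Fin n) → Set
IsPath G p = Unique p × Linked (Adj G) p

Ends : ∀ {n} → List (Fin n) → Fin n → Fin n → Set
Ends p a b = ∃ λ mid → p ≡ a ∷ (mid ++ b ∷ [])

IsABPath : ∀ {n} → Graph n → (u v w x : Fin n) → List (Fin n) → Set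
IsABPath G u v w x p =
  IsPath G p × (∃ λ a → ∃ λ b → (a ≡ u ⊎ a ≡ v) × (b ≡ w ⊎ b ≡ x) × Ends p a b)

Disjoint : ∀ {n} → List (Fin n) → List (Fin n) → Set
Disjoint p q = ∀ {y} → y ∈ p → y ∉ q

module Submission where

-- Add the edges uv and wx to G and look at cyclic orderings of V(G) in which u, v and w, x are
-- consecutive, counting as defects the consecutive pairs that are not edges of G + uv + wx. If the
-- closing pair l–h of such an ordering h … l is a defect, count the neighbours of h among the
-- successors and those of l among the predecessors of the links a–b along the path h … l: as
-- deg h + deg l ≥ n + 2 exceeds the n − 1 links plus the two links u–v and w–x, some other link
-- has h ~ b and l ~ a, and reversing the segment b … l trades the defect l–h for the edges a–l
-- and b–h. So G + uv + wx has a Hamiltonian cycle through uv and wx, and deleting these two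
-- edges leaves the two paths.

open import Defs hiding (sym)
open import Data.Nat using (ℕ; zero; suc; _+_; _*_; _≤_; _<_; z≤n; s≤s)
open import Data.Nat.Properties
  using (+-comm; +-assoc; +-identityʳ; ≤-refl; ≤-trans; ≤-pred; +-mono-≤; +-monoˡ-≤; +-monoʳ-≤;
         +-cancelˡ-≤; *-cancelˡ-≤; *-distribˡ-+; m≤m+n; m≤n+m; m+n≡0⇒m≡0; m+n≡0⇒n≡0; n≤0⇒n≡0;
         module ≤-Reasoning)
import Data.Nat.Properties as ℕ
open import Data.Nat.Tactic.RingSolver using (solve-∀)
open import Data.Fin using (Fin)
open import Data.Fin.Properties using (_≟_)
open import Data.List using (List; []; _∷_; _++_; length; filter; allFin; reverse)
open import Data.List.Properties using (unfold-reverse; length-tabulate; ∷-injective)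
open import Data.List.Membership.Propositional using (_∈_; _∉_)
open import Data.List.Membership.Propositional.Properties
  using (∈-++⁺ˡ; ∈-++⁺ʳ; ∈-++⁻; ∈-filter⁺; ∈-filter⁻; ∈-allFin)
open import Data.List.Membership.Propositional.Properties.WithK using (unique∧set⇒bag)
import Data.List.Membership.DecPropositional as DecMembership
open import Data.List.Relation.Unary.Any using (here; there)
import Data.List.Relation.Unary.All as All
import Data.List.Relation.Unary.All.Properties as All
open import Data.List.Relation.Unary.All using ([]; _∷_)
open import Data.List.Relation.Unary.AllPairs using ([]; _∷_)
open import Data.List.Relation.Unary.Linked using (Linked; [-]; _∷_)
import Data.List.Relation.Unary.Linked as Linked
open import Data.List.Relation.Unary.Unique.Propositional using (Unique)
import Data.List.Relation.Unary.Unique.Propositional.Properties as Unique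
open import Data.List.Relation.Binary.BagAndSetEquality using (∼bag⇒↭)
open import Data.List.Relation.Binary.Permutation.Propositional
  using (_↭_; ↭-sym; ↭-trans; ↭⇒↭ₛ)
open import Data.List.Relation.Binary.Permutation.Propositional.Properties
  using (↭-length; filter-↭; ↭-reverse; ++-comm; ++⁺ˡ; ∈-resp-↭)
import Data.List.Relation.Binary.Permutation.Setoid.Properties as Permutationₛ
open import Data.Product using (Σ; ∃; _×_; _,_; proj₁; proj₂)
open import Data.Sum using (_⊎_; inj₁; inj₂)
import Data.Sum as Sum
open import Data.Empty using (⊥-elim)
open import Function using (id; _∘_)
open import Function.Bundles using (mk⇔)
open import Relation.Nullary using (¬_; Dec; yes; no)
open import Relation.Nullary.Decidable using (_×-dec_; _⊎-dec_; ¬?)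
open import Relation.Unary using () renaming (Decidable to Decidable₁)
open import Relation.Binary using (Rel)
open import Relation.Binary.PropositionalEquality
  using (_≡_; _≢_; refl; sym; trans; cong; cong₂; subst; subst₂; setoid; module ≡-Reasoning)

iverson : {P : Set} → Dec P → ℕ
iverson (yes _) = 1
iverson (no _) = 0

module _ {P : Set} where

  iverson-yes : P → (d : Dec P) → iverson d ≡ 1
  iverson-yes _ (yes _) = refl
  iverson-yes p (no ¬p) = ⊥-elim (¬p p)

  iverson-no : ¬ P → (d : Dec P) → iverson d ≡ 0
  iverson-no ¬p (yes p) = ⊥-elim (¬p p)
  iverson-no _ (no _) = refl

  iverson-sound : (d : Dec P) → 1 ≤ iverson d → P
  iverson-sound (yes p) _ = p

  iverson-¬-zero : (d : Dec P) → iverson (¬? d) ≡ 0 → P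
  iverson-¬-zero (yes p) _ = p

  iverson≤1 : (d : Dec P) → iverson d ≤ 1
  iverson≤1 (yes _) = ≤-refl
  iverson≤1 (no _) = z≤n

  iverson-cong : {Q : Set} → (P → Q) → (Q → P) → (p : Dec P) (q : Dec Q) → iverson p ≡ iverson q
  iverson-cong _ _ (yes _) (yes _) = refl
  iverson-cong f _ (yes p) (no ¬q) = ⊥-elim (¬q (f p))
  iverson-cong _ g (no ¬p) (yes q) = ⊥-elim (¬p (g q))
  iverson-cong _ _ (no _) (no _) = refl

iverson-sum-bound : {P Q R S : Set} (p : Dec P) (q : Dec Q) (r : Dec R) (s : Dec S) →
  iverson p + iverson q ≤ 1 + iverson r + iverson s + iverson (p ×-dec q ×-dec ¬? r ×-dec ¬? s)
iverson-sum-bound (yes _) (yes _) (yes _) _       = s≤s (s≤s z≤n)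
iverson-sum-bound (yes _) (yes _) (no _)  (yes _) = ≤-refl
iverson-sum-bound (yes _) (yes _) (no _)  (no _)  = ≤-refl
iverson-sum-bound (yes _) (no _)  _       _       = s≤s z≤n
iverson-sum-bound (no _)  q       _       _       = ≤-trans (iverson≤1 q) (s≤s z≤n)

+-halves : ∀ {m a b} → m ≤ 2 * a → m ≤ 2 * b → m ≤ a + b
+-halves {m} {a} {b} m≤2a m≤2b = *-cancelˡ-≤ 2 (begin
  2 * m         ≡⟨ cong (m +_) (+-identityʳ m) ⟩
  m + m         ≤⟨ +-mono-≤ m≤2a m≤2b ⟩
  2 * a + 2 * b ≡⟨ *-distribˡ-+ 2 a b ⟨
  2 * (a + b)   ∎)
  where open ≤-Reasoning

m+0+0≡n+p+q⇒n≤m : ∀ {m n p q} → m + 0 + 0 ≡ n + p + q → n ≤ m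
m+0+0≡n+p+q⇒n≤m {m} {n} {p} {q} eq = begin
  n         ≤⟨ m≤m+n n p ⟩
  n + p     ≤⟨ m≤m+n (n + p) q ⟩
  n + p + q ≡⟨ eq ⟨
  m + 0 + 0 ≡⟨ cong (_+ 0) (+-identityʳ m) ⟩
  m + 0     ≡⟨ +-identityʳ m ⟩
  m         ∎
  where open ≤-Reasoning

m+p+1≡n+0+0⇒m<n : ∀ {m n p} → m + p + 1 ≡ n + 0 + 0 → m < n
m+p+1≡n+0+0⇒m<n {m} {n} {p} eq = begin
  suc m     ≤⟨ s≤s (m≤m+n m p) ⟩
  suc (m + p) ≡⟨ +-comm 1 (m + p) ⟩
  m + p + 1 ≡⟨ eq ⟩
  n + 0 + 0 ≡⟨ cong (_+ 0) (+-identityʳ n) ⟩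
  n + 0     ≡⟨ +-identityʳ n ⟩
  n         ∎
  where open ≤-Reasoning

module _ {A : Set} where

  last : A → List A → A
  last a [] = a
  last _ (b ∷ r) = last b r

  last-++ : ∀ a r b s → last a (r ++ b ∷ s) ≡ last b s
  last-++ a [] b s = refl
  last-++ a (c ∷ r) b s = last-++ c r b s

  last-∈ : ∀ a r → last a r ∈ a ∷ r
  last-∈ a [] = here refl
  last-∈ a (b ∷ r) = there (last-∈ b r)

  ∷-last : ∀ a r → ∃ λ init → a ∷ r ≡ init ++ last a r ∷ []
  ∷-last a [] = [] , refl
  ∷-last a (b ∷ r) with ∷-last b r
  ... | init , eq = a ∷ init , cong (a ∷_) eq

  reverse-∷ : ∀ a r → ∃ λ r′ → reverse (a ∷ r) ≡ last a r ∷ r′ × last (last a r) r′ ≡ a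
  reverse-∷ a [] = [] , refl , refl
  reverse-∷ a (b ∷ s) with reverse-∷ b s
  ... | r′ , reversed , _ =
    r′ ++ a ∷ [] ,
    trans (unfold-reverse a (b ∷ s)) (cong (_++ a ∷ []) reversed) ,
    last-++ (last b s) r′ a []

  Unique-++⁻ : ∀ xs {ys : List A} → Unique (xs ++ ys) →
               Unique xs × Unique ys × (∀ {y} → y ∈ xs → y ∉ ys)
  Unique-++⁻ [] U = [] , U , λ ()
  Unique-++⁻ (x ∷ xs) {ys} (x∉ ∷ U) with Unique-++⁻ xs U
  ... | Uxs , Uys , apart = All.++⁻ˡ xs x∉ ∷ Uxs , Uys , apart′
    where
      apart′ : ∀ {y} → y ∈ x ∷ xs → y ∉ ys
      apart′ (here refl) y∈ys = All.lookup (All.++⁻ʳ xs x∉) y∈ys refl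
      apart′ (there y∈xs) = apart y∈xs

  Unique-resp-↭ : ∀ {xs ys : List A} → xs ↭ ys → Unique xs → Unique ys
  Unique-resp-↭ xs↭ys = Permutationₛ.Unique-resp-↭ (setoid A) (↭⇒↭ₛ xs↭ys)

ends : ∀ {n} (a : Fin n) r → a ≢ last a r → Ends (a ∷ r) a (last a r)
ends a [] a≢a = ⊥-elim (a≢a refl)
ends a (b ∷ r) _ with ∷-last b r
... | init , eq = init , cong (a ∷_) eq

module _ {n : ℕ} where
  open DecMembership (_≟_ {n}) using (_∈?_; _∉?_)

  ++-missing-↭-allFin : {xs : List (Fin n)} → Unique xs → xs ++ filter (_∉? xs) (allFin n) ↭ allFin n
  ++-missing-↭-allFin {xs} U =
    ∼bag⇒↭ (unique∧set⇒bag U′ (Unique.allFin⁺ n) (mk⇔ (λ _ → ∈-allFin _) covered))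
    where
      U′ : Unique (xs ++ filter (_∉? xs) (allFin n))
      U′ = Unique.++⁺ U (Unique.filter⁺ (_∉? xs) (Unique.allFin⁺ n))
             (λ (y∈xs , y∈rest) → proj₂ (∈-filter⁻ (_∉? xs) {xs = allFin n} y∈rest) y∈xs)
      covered : ∀ {y} → y ∈ allFin n → y ∈ xs ++ filter (_∉? xs) (allFin n)
      covered {y} _ with y ∈? xs
      ... | yes y∈xs = ∈-++⁺ˡ y∈xs
      ... | no y∉xs = ∈-++⁺ʳ xs (∈-filter⁺ (_∉? xs) (∈-allFin y) y∉xs)

-- Weights of consecutive pairs along a path and around a cycle

Weight : Set → Set
Weight A = A → A → ℕ

module _ {A : Set} where

  infixl 6 _⊕_
  _⊕_ : Weight A → Weight A → Weight A
  (W ⊕ V) a b = W a b + V a b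

  Undirected : Weight A → Set
  Undirected W = ∀ a b → W a b ≡ W b a

  pathWeight : Weight A → A → List A → ℕ
  pathWeight W a [] = 0
  pathWeight W a (b ∷ r) = W a b + pathWeight W b r

  cycleWeight : Weight A → A → List A → ℕ
  cycleWeight W a r = pathWeight W a r + W (last a r) a

  pathWeight-++ : ∀ W a r b s →
                  pathWeight W a (r ++ b ∷ s) ≡ pathWeight W a r + W (last a r) b + pathWeight W b s
  pathWeight-++ W a [] b s = refl
  pathWeight-++ W a (c ∷ r) b s = begin
    W a c + pathWeight W c (r ++ b ∷ s)
      ≡⟨ cong (W a c +_) (pathWeight-++ W c r b s) ⟩
    W a c + (pathWeight W c r + W (last c r) b + pathWeight W b s)
      ≡⟨ reassoc (W a c) (pathWeight W c r) (W (last c r) b) (pathWeight W b s) ⟩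
    W a c + pathWeight W c r + W (last c r) b + pathWeight W b s ∎
    where
      open ≡-Reasoning
      reassoc : ∀ p q r s → p + (q + r + s) ≡ p + q + r + s
      reassoc = solve-∀

  pathWeight-⊕ : ∀ W V a r → pathWeight (W ⊕ V) a r ≡ pathWeight W a r + pathWeight V a r
  pathWeight-⊕ W V a [] = refl
  pathWeight-⊕ W V a (b ∷ r) =
    trans (cong (W a b + V a b +_) (pathWeight-⊕ W V b r))
          (interchange (W a b) (V a b) (pathWeight W b r) (pathWeight V b r))
    where
      interchange : ∀ p q r s → p + q + (r + s) ≡ p + r + (q + s)
      interchange = solve-∀

  pathWeight-mono : ∀ {W V} → (∀ a b → W a b ≤ V a b) → ∀ a r → pathWeight W a r ≤ pathWeight V a r
  pathWeight-mono W≤V a [] = z≤n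
  pathWeight-mono W≤V a (b ∷ r) = +-mono-≤ (W≤V a b) (pathWeight-mono W≤V b r)

  pathWeight-one : ∀ a r → pathWeight (λ _ _ → 1) a r ≡ length r
  pathWeight-one a [] = refl
  pathWeight-one a (b ∷ r) = cong suc (pathWeight-one b r)

  pathWeight-split : ∀ W a r → 1 ≤ pathWeight W a r →
                     ∃ λ r₁ → ∃ λ b → ∃ λ s → r ≡ r₁ ++ b ∷ s × 1 ≤ W (last a r₁) b
  pathWeight-split W a (b ∷ s) pos with W a b in link
  ... | suc _ = [] , b , s , refl , subst (1 ≤_) (sym link) (s≤s z≤n)
  ... | zero with pathWeight-split W b s pos
  ...   | r₁ , c , s′ , refl , link = b ∷ r₁ , c , s′ , refl , link

  pathWeight-++-zero : ∀ W a r b s → pathWeight W a (r ++ b ∷ s) ≡ 0 →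
                       pathWeight W a r ≡ 0 × pathWeight W b s ≡ 0
  pathWeight-++-zero W a r b s zero-weight =
    m+n≡0⇒m≡0 _ (m+n≡0⇒m≡0 _ split) , m+n≡0⇒n≡0 _ split
    where split = trans (sym (pathWeight-++ W a r b s)) zero-weight

  pathWeight-zero⇒Linked : ∀ W a r → pathWeight W a r ≡ 0 → Linked (λ p q → W p q ≡ 0) (a ∷ r)
  pathWeight-zero⇒Linked W a [] _ = [-]
  pathWeight-zero⇒Linked W a (b ∷ r) zero-weight =
    m+n≡0⇒m≡0 _ zero-weight ∷ pathWeight-zero⇒Linked W b r (m+n≡0⇒n≡0 _ zero-weight)

  cycleWeight-rotate : ∀ W h r b s → cycleWeight W h (r ++ b ∷ s) ≡ cycleWeight W b (s ++ h ∷ r)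
  cycleWeight-rotate W h r b s
    rewrite pathWeight-++ W h r b s | last-++ h r b s | pathWeight-++ W b s h r | last-++ b s h r =
    rotation (pathWeight W h r) (W (last h r) b) (pathWeight W b s) (W (last b s) h)
    where
      rotation : ∀ p q r s → p + q + r + s ≡ r + s + p + q
      rotation = solve-∀

  module _ {W : Weight A} (W-undirected : Undirected W) where

    pathWeight-reverse : ∀ a r {c r′} → reverse (a ∷ r) ≡ c ∷ r′ → pathWeight W c r′ ≡ pathWeight W a r
    pathWeight-reverse a [] refl = refl
    pathWeight-reverse a (b ∷ s) {c} {r′} reversed with reverse-∷ b s
    ... | r″ , reversed-bs , last≡b
      with refl , refl ← ∷-injective (trans (sym reversed)
                           (trans (unfold-reverse a (b ∷ s)) (cong (_++ a ∷ []) reversed-bs))) = begin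
      pathWeight W (last b s) (r″ ++ a ∷ [])
        ≡⟨ pathWeight-++ W (last b s) r″ a [] ⟩
      pathWeight W (last b s) r″ + W (last (last b s) r″) a + 0
        ≡⟨ cong₂ (λ p q → p + W q a + 0) (pathWeight-reverse b s reversed-bs) last≡b ⟩
      pathWeight W b s + W b a + 0
        ≡⟨ cong (_+ 0) (trans (+-comm (pathWeight W b s) (W b a))
                              (cong (_+ pathWeight W b s) (W-undirected b a))) ⟩
      W a b + pathWeight W b s + 0
        ≡⟨ +-identityʳ _ ⟩
      W a b + pathWeight W b s ∎
      where open ≡-Reasoning

    cycleWeight-reverse : ∀ h t r′ → reverse (h ∷ t) ≡ last h t ∷ r′ → last (last h t) r′ ≡ h →
                          cycleWeight W (last h t) r′ ≡ cycleWeight W h t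
    cycleWeight-reverse h t r′ reversed last≡h rewrite last≡h =
      cong₂ _+_ (pathWeight-reverse h t reversed) (W-undirected h (last h t))

    -- The 2-opt move: reversing the segment b … l of the cycle h … a b … l replaces the links
    -- a–b and l–h by a–l and b–h.
    cycleWeight-exchange : ∀ h r b s r′ → reverse (b ∷ s) ≡ last b s ∷ r′ → last (last b s) r′ ≡ b →
      cycleWeight W h (r ++ last b s ∷ r′) + W (last h r) b + W (last b s) h ≡
      cycleWeight W h (r ++ b ∷ s) + W (last h r) (last b s) + W b h
    cycleWeight-exchange h r b s r′ reversed last≡b
      rewrite pathWeight-++ W h r (last b s) r′ | last-++ h r (last b s) r′ | last≡b
            | pathWeight-reverse b s reversed | pathWeight-++ W h r b s | last-++ h r b s =
      swap (pathWeight W h r) (W (last h r) (last b s)) (pathWeight W b s) (W b h)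
           (W (last h r) b) (W (last b s) h)
      where
        swap : ∀ p x q y z t → p + x + q + y + z + t ≡ p + z + q + t + x + y
        swap = solve-∀

  module _ {P : A → Set} (P? : Decidable₁ P) where

    length-filter-∷ : ∀ a r → length (filter P? (a ∷ r)) ≡ iverson (P? a) + length (filter P? r)
    length-filter-∷ a r with P? a
    ... | yes _ = refl
    ... | no _ = refl

    length-filter≡targets : ∀ a r →
      length (filter P? (a ∷ r)) ≡ iverson (P? a) + pathWeight (λ _ b → iverson (P? b)) a r
    length-filter≡targets a [] = length-filter-∷ a []
    length-filter≡targets a (b ∷ r) =
      trans (length-filter-∷ a (b ∷ r)) (cong (iverson (P? a) +_) (length-filter≡targets b r))

    length-filter≡sources : ∀ a r →
      length (filter P? (a ∷ r)) ≡ pathWeight (λ c _ → iverson (P? c)) a r + iverson (P? (last a r))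
    length-filter≡sources a [] = trans (length-filter-∷ a []) (+-comm (iverson (P? a)) 0)
    length-filter≡sources a (b ∷ r) =
      trans (length-filter-∷ a (b ∷ r))
            (trans (cong (iverson (P? a) +_) (length-filter≡sources b r)) (sym (+-assoc (iverson (P? a)) _ _)))

module _ {A : Set} where

  Joins : A → A → A → A → Set
  Joins p q a b = (a ≡ p × b ≡ q) ⊎ (a ≡ q × b ≡ p)

  module _ {p q a b : A} where

    Joins-sym : Joins p q a b → Joins p q b a
    Joins-sym (inj₁ (a≡p , b≡q)) = inj₂ (b≡q , a≡p)
    Joins-sym (inj₂ (a≡q , b≡p)) = inj₁ (b≡p , a≡q)

    Joins-source : Joins p q a b → a ≡ p ⊎ a ≡ q
    Joins-source (inj₁ (a≡p , _)) = inj₁ a≡p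
    Joins-source (inj₂ (a≡q , _)) = inj₂ a≡q

    Joins-∈ : ∀ {xs} → Joins p q a b → a ∈ xs → b ∈ xs → p ∈ xs × q ∈ xs
    Joins-∈ (inj₁ (refl , refl)) a∈ b∈ = a∈ , b∈
    Joins-∈ (inj₂ (refl , refl)) a∈ b∈ = b∈ , a∈

    Joins-∉ : ∀ {xs} → Joins p q a b → a ∉ xs → p ∉ xs ⊎ q ∉ xs
    Joins-∉ j a∉ with Joins-source j
    ... | inj₁ refl = inj₁ a∉
    ... | inj₂ refl = inj₂ a∉

-- Hamiltonian tours through the two extra edges

module Tours {n : ℕ} (G : Graph n) (u v w x : Fin n) where

  open DecMembership (_≟_ {n}) using (_∉?_)

  joins? : (p q a b : Fin n) → Dec (Joins p q a b)
  joins? p q a b = (a ≟ p ×-dec b ≟ q) ⊎-dec (a ≟ q ×-dec b ≟ p)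

  J : Fin n → Fin n → Weight (Fin n)
  J p q a b = iverson (joins? p q a b)

  J-undirected : ∀ p q → Undirected (J p q)
  J-undirected p q a b = iverson-cong Joins-sym Joins-sym (joins? p q a b) (joins? p q b a)

  pathWeight-J-absent : ∀ p q a r → p ∉ a ∷ r ⊎ q ∉ a ∷ r → pathWeight (J p q) a r ≡ 0
  pathWeight-J-absent p q a [] _ = refl
  pathWeight-J-absent p q a (b ∷ r) absent =
    cong₂ _+_ (iverson-no ¬joins (joins? p q a b))
              (pathWeight-J-absent p q b r (Sum.map (λ p∉ → p∉ ∘ there) (λ q∉ → q∉ ∘ there) absent))
    where
      ¬joins : ¬ Joins p q a b
      ¬joins j = let p∈ , q∈ = Joins-∈ j (here refl) (there (here refl))
                 in Sum.[ (λ p∉ → p∉ p∈) , (λ q∉ → q∉ q∈) ] absent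

  pathWeight-J≤1 : ∀ p q a r → Unique (a ∷ r) → pathWeight (J p q) a r ≤ 1
  pathWeight-J≤1 p q a [] _ = z≤n
  pathWeight-J≤1 p q a (b ∷ r) (a∉ ∷ U) with joins? p q a b
  ... | yes j =
    ℕ.≤-reflexive (cong suc (pathWeight-J-absent p q b r (Joins-∉ j (λ a∈ → All.lookup a∉ a∈ refl))))
  ... | no _ = pathWeight-J≤1 p q b r U

  infix 4 _~_ _~?_

  _~_ : Rel (Fin n) _
  a ~ b = Adj G a b ⊎ Joins u v a b ⊎ Joins w x a b

  _~?_ : (a b : Fin n) → Dec (a ~ b)
  a ~? b = adj? G a b ⊎-dec joins? u v a b ⊎-dec joins? w x a b

  ~-sym : ∀ {a b} → a ~ b → b ~ a
  ~-sym = Sum.map (Graph.sym G) (Sum.map Joins-sym Joins-sym)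

  defect : Weight (Fin n)
  defect a b = iverson (¬? (a ~? b))

  defect-undirected : Undirected defect
  defect-undirected a b = iverson-cong (λ ≁ → ≁ ∘ ~-sym) (λ ≁ → ≁ ∘ ~-sym) (¬? (a ~? b)) (¬? (b ~? a))

  defect-adj : ∀ {a b} → Adj G a b → defect a b ≡ 0
  defect-adj {a} {b} a-b = iverson-no (λ ≁ → ≁ (inj₁ a-b)) (¬? (a ~? b))

  -- A cyclic ordering of the vertices in which u, v and w, x are neighbours; without defects it is
  -- a Hamiltonian cycle of G + uv + wx.
  record Tour : Set where
    constructor tour
    field
      head : Fin n
      tail : List (Fin n)
      spans : head ∷ tail ↭ allFin n
      uv-link : 1 ≤ cycleWeight (J u v) head tail
      wx-link : 1 ≤ cycleWeight (J w x) head tail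

    final : Fin n
    final = last head tail

    defects : ℕ
    defects = cycleWeight defect head tail

  open Tour

  Unique-tour : (α : Tour) → Unique (head α ∷ tail α)
  Unique-tour α = Unique-resp-↭ (↭-sym (spans α)) (Unique.allFin⁺ n)

  ∈-tour : (α : Tour) → ∀ y → y ∈ head α ∷ tail α
  ∈-tour α y = ∈-resp-↭ (↭-sym (spans α)) (∈-allFin y)

  length-tour : (α : Tour) → suc (length (tail α)) ≡ n
  length-tour α = trans (↭-length (spans α)) (length-tabulate id)

  degree-tour : (α : Tour) → ∀ y → degree G y ≡ length (filter (adj? G y) (head α ∷ tail α))
  degree-tour α y = sym (↭-length (filter-↭ (adj? G y) (spans α)))

  rotateOnto : (W : Weight (Fin n)) (α : Tour) → 1 ≤ cycleWeight W (head α) (tail α) →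
               Σ Tour λ β → defects β ≡ defects α × 1 ≤ W (final β) (head β)
  rotateOnto W α@(tour h t σ uv wx) pos with W (last h t) h in closing
  ... | suc _ = α , refl , subst (1 ≤_) (sym closing) (s≤s z≤n)
  ... | zero with pathWeight-split W h t (subst (1 ≤_) (+-identityʳ _) pos)
  ...   | r , b , s , refl , link =
    tour b (s ++ h ∷ r) (↭-trans (++-comm (b ∷ s) (h ∷ r)) σ) (rotated uv) (rotated wx) ,
    sym (cycleWeight-rotate defect h r b s) ,
    subst (λ l → 1 ≤ W l b) (sym (last-++ b s h r)) link
    where
      rotated : ∀ {V} → 1 ≤ cycleWeight V h (r ++ b ∷ s) → 1 ≤ cycleWeight V b (s ++ h ∷ r)
      rotated = subst (1 ≤_) (cycleWeight-rotate _ h r b s)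

  reverseTour : (α : Tour) → Σ Tour λ β → defects β ≡ defects α × head β ≡ final α × final β ≡ head α
  reverseTour (tour h t σ uv wx) with reverse-∷ h t
  ... | r′ , reversed , last≡h =
    tour (last h t) r′ (subst (_↭ allFin n) reversed (↭-trans (↭-reverse (h ∷ t)) σ))
         (reversed-link (J-undirected u v) uv) (reversed-link (J-undirected w x) wx) ,
    cycleWeight-reverse defect-undirected h t r′ reversed last≡h , refl , last≡h
    where
      reversed-link : ∀ {V} → Undirected V → 1 ≤ cycleWeight V h t → 1 ≤ cycleWeight V (last h t) r′
      reversed-link V-undirected = subst (1 ≤_) (sym (cycleWeight-reverse V-undirected h t r′ reversed last≡h))

  -- The link a–b of the path from h to l can be traded for the missing closing link l–h.
  Exchangeable : Fin n → Fin n → Fin n → Fin n → Set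
  Exchangeable h l a b = Adj G h b × Adj G l a × ¬ Joins u v a b × ¬ Joins w x a b

  exchangeable? : ∀ h l a b → Dec (Exchangeable h l a b)
  exchangeable? h l a b = adj? G h b ×-dec adj? G l a ×-dec ¬? (joins? u v a b) ×-dec ¬? (joins? w x a b)

  exchange : (α : Tour) → ¬ final α ~ head α → ∀ r b s → tail α ≡ r ++ b ∷ s →
             Exchangeable (head α) (final α) (last (head α) r) b → Σ Tour λ β → defects β < defects α
  exchange (tour h t σ uv wx) gap r b s refl (h-b , l-a , ¬uv , ¬wx) with reverse-∷ b s
  ... | r′ , reversed , last≡b =
    tour h (r ++ l ∷ r′) σ′
      (kept (λ j → gap′ (inj₂ (inj₁ j))) ¬uv uv) (kept (λ j → gap′ (inj₂ (inj₂ j))) ¬wx wx) ,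
    fewer
    where
      a = last h r
      l = last b s
      gap′ : ¬ l ~ h
      gap′ = subst (λ y → ¬ y ~ h) (last-++ h r b s) gap
      σ′ : h ∷ r ++ l ∷ r′ ↭ allFin n
      σ′ = ↭-trans (subst (λ ys → h ∷ r ++ ys ↭ h ∷ r ++ b ∷ s) reversed (++⁺ˡ (h ∷ r) (↭-reverse (b ∷ s)))) σ

      exchanged : ∀ {V} → Undirected V →
                  cycleWeight V h (r ++ l ∷ r′) + V a b + V l h ≡ cycleWeight V h (r ++ b ∷ s) + V a l + V b h
      exchanged V-undirected = cycleWeight-exchange V-undirected h r b s r′ reversed last≡b

      kept : ∀ {p q} → ¬ Joins p q l h → ¬ Joins p q a b →
             1 ≤ cycleWeight (J p q) h (r ++ b ∷ s) → 1 ≤ cycleWeight (J p q) h (r ++ l ∷ r′)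
      kept {p} {q} ¬lh ¬ab pos = ≤-trans pos (m+0+0≡n+p+q⇒n≤m (begin
        cycleWeight (J p q) h (r ++ l ∷ r′) + 0 + 0
          ≡⟨ cong₂ (λ y z → cycleWeight (J p q) h (r ++ l ∷ r′) + y + z)
                   (iverson-no ¬ab (joins? p q a b)) (iverson-no ¬lh (joins? p q l h)) ⟨
        cycleWeight (J p q) h (r ++ l ∷ r′) + J p q a b + J p q l h
          ≡⟨ exchanged (J-undirected p q) ⟩
        cycleWeight (J p q) h (r ++ b ∷ s) + J p q a l + J p q b h ∎))
        where open ≡-Reasoning

      fewer : cycleWeight defect h (r ++ l ∷ r′) < cycleWeight defect h (r ++ b ∷ s)
      fewer = m+p+1≡n+0+0⇒m<n (begin
        cycleWeight defect h (r ++ l ∷ r′) + defect a b + 1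
          ≡⟨ cong (cycleWeight defect h (r ++ l ∷ r′) + defect a b +_) (iverson-yes gap′ (¬? (l ~? h))) ⟨
        cycleWeight defect h (r ++ l ∷ r′) + defect a b + defect l h
          ≡⟨ exchanged defect-undirected ⟩
        cycleWeight defect h (r ++ b ∷ s) + defect a l + defect b h
          ≡⟨ cong₂ (λ y z → cycleWeight defect h (r ++ b ∷ s) + y + z)
                   (defect-adj (Graph.sym G (subst (λ y → Adj G y a) (last-++ h r b s) l-a)))
                   (defect-adj (Graph.sym G h-b)) ⟩
        cycleWeight defect h (r ++ b ∷ s) + 0 + 0 ∎)
        where open ≡-Reasoning

  exchangeCount : Fin n → Fin n → Weight (Fin n)
  exchangeCount h l a b = iverson (exchangeable? h l a b)

  degree-head : (α : Tour) →
    degree G (head α) ≡ pathWeight (λ _ b → iverson (adj? G (head α) b)) (head α) (tail α)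
  degree-head α@(tour h t _ _ _) =
    trans (degree-tour α h)
      (trans (length-filter≡targets (adj? G h) h t)
        (cong (_+ pathWeight (λ _ b → iverson (adj? G h b)) h t) (iverson-no (Graph.irrefl G) (adj? G h h))))

  degree-final : (α : Tour) →
    degree G (final α) ≡ pathWeight (λ a _ → iverson (adj? G (final α) a)) (head α) (tail α)
  degree-final α@(tour h t _ _ _) =
    trans (degree-tour α (last h t))
      (trans (length-filter≡sources (adj? G (last h t)) h t)
        (trans (cong (pathWeight (λ a _ → iverson (adj? G (last h t) a)) h t +_)
                     (iverson-no (Graph.irrefl G) (adj? G (last h t) (last h t))))
               (+-identityʳ _)))

  -- Each link a–b contributes at most one to deg h + deg l unless it is exchangeable or it is
  -- one of the two links u–v and w–x, which occur at most once each.
  degree-sum≤ : (α : Tour) → degree G (head α) + degree G (final α) ≤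
    length (tail α) + 1 + 1 + pathWeight (exchangeCount (head α) (final α)) (head α) (tail α)
  degree-sum≤ α@(tour h t _ _ _) = begin
    degree G h + degree G l
      ≡⟨ cong₂ _+_ (degree-head α) (degree-final α) ⟩
    pathWeight toH h t + pathWeight fromL h t
      ≡⟨ pathWeight-⊕ toH fromL h t ⟨
    pathWeight (toH ⊕ fromL) h t
      ≤⟨ pathWeight-mono (λ a b → iverson-sum-bound (adj? G h b) (adj? G l a) (joins? u v a b) (joins? w x a b))
                         h t ⟩
    pathWeight (one ⊕ J u v ⊕ J w x ⊕ E) h t
      ≡⟨ pathWeight-⊕ (one ⊕ J u v ⊕ J w x) E h t ⟩
    pathWeight (one ⊕ J u v ⊕ J w x) h t + pathWeight E h t
      ≡⟨ cong (_+ pathWeight E h t) (pathWeight-⊕ (one ⊕ J u v) (J w x) h t) ⟩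
    pathWeight (one ⊕ J u v) h t + pathWeight (J w x) h t + pathWeight E h t
      ≡⟨ cong (λ y → y + pathWeight (J w x) h t + pathWeight E h t)
              (trans (pathWeight-⊕ one (J u v) h t) (cong (_+ pathWeight (J u v) h t) (pathWeight-one h t))) ⟩
    length t + pathWeight (J u v) h t + pathWeight (J w x) h t + pathWeight E h t
      ≤⟨ +-monoˡ-≤ (pathWeight E h t)
           (+-mono-≤ (+-monoʳ-≤ (length t) (pathWeight-J≤1 u v h t U)) (pathWeight-J≤1 w x h t U)) ⟩
    length t + 1 + 1 + pathWeight E h t ∎
    where
      open ≤-Reasoning
      l = last h t
      U = Unique-tour α
      toH fromL one E : Weight (Fin n)
      toH _ b = iverson (adj? G h b)
      fromL a _ = iverson (adj? G l a)
      one _ _ = 1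
      E = exchangeCount h l

  exchangeableLink : (∀ y → n + 2 ≤ 2 * degree G y) → (α : Tour) →
    ∃ λ r → ∃ λ b → ∃ λ s → tail α ≡ r ++ b ∷ s × Exchangeable (head α) (final α) (last (head α) r) b
  exchangeableLink δ α@(tour h t _ _ _) =
    let r , b , s , split , pos = pathWeight-split (exchangeCount h l) h t (slack (length t) _ counted)
    in r , b , s , split , iverson-sound (exchangeable? h l (last h r) b) pos
    where
      l = last h t
      counted : suc (length t) + 2 ≤ length t + 1 + 1 + pathWeight (exchangeCount h l) h t
      counted = ≤-trans (subst (λ m → m + 2 ≤ degree G h + degree G l) (sym (length-tour α))
                                 (+-halves {a = degree G h} {b = degree G l} (δ h) (δ l)))
                        (degree-sum≤ α)
      slack : ∀ m k → suc m + 2 ≤ m + 1 + 1 + k → 1 ≤ k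
      slack m k le = +-cancelˡ-≤ (m + 2) 1 k (subst₂ _≤_ (shuffle₁ m) (shuffle₂ m k) le)
        where
          shuffle₁ : ∀ m → suc m + 2 ≡ m + 2 + 1
          shuffle₁ = solve-∀
          shuffle₂ : ∀ m k → m + 1 + 1 + k ≡ m + 2 + k
          shuffle₂ = solve-∀

  improve : (∀ y → n + 2 ≤ 2 * degree G y) → (α : Tour) → 1 ≤ defects α → Σ Tour λ β → defects β < defects α
  improve δ α imperfect =
    let β , same , gap = rotateOnto defect α imperfect
        r , b , s , split , exchangeable = exchangeableLink δ β
        γ , fewer = exchange β (iverson-sound (¬? (final β ~? head β)) gap) r b s split exchangeable
    in γ , subst (defects γ <_) same fewer

  perfectTourWithin : (∀ y → n + 2 ≤ 2 * degree G y) → ∀ k (α : Tour) → defects α ≤ k →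
                      Σ Tour λ β → defects β ≡ 0
  perfectTourWithin δ zero α bound = α , n≤0⇒n≡0 bound
  perfectTourWithin δ (suc k) α bound with 1 ℕ.≤? defects α
  ... | no perfect = α , n≤0⇒n≡0 (ℕ.≮⇒≥ perfect)
  ... | yes imperfect =
    let β , fewer = improve δ α imperfect in perfectTourWithin δ k β (≤-pred (≤-trans fewer bound))

  perfectTour : (∀ y → n + 2 ≤ 2 * degree G y) → Tour → Σ Tour λ β → defects β ≡ 0
  perfectTour δ α = perfectTourWithin δ (defects α) α ≤-refl

  orient : (α : Tour) → Σ Tour λ β → defects β ≡ defects α × head β ≡ u × final β ≡ v
  orient α with rotateOnto (J u v) α (uv-link α)
  ... | β , same , closing with iverson-sound (joins? u v (final β) (head β)) closing
  ...   | inj₂ (final≡v , head≡u) = β , same , head≡u , final≡v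
  ...   | inj₁ (final≡u , head≡v) with reverseTour β
  ...     | γ , same′ , head≡final , final≡head =
    γ , trans same′ same , trans head≡final final≡u , trans final≡head head≡v

  initialTour : u ≢ v → w ≢ x → u ≢ w → u ≢ x → v ≢ w → v ≢ x → Tour
  initialTour u≢v w≢x u≢w u≢x v≢w v≢x =
    tour u (v ∷ w ∷ x ∷ others) (++-missing-↭-allFin corners-unique) uv-linked wx-linked
    where
      open ≤-Reasoning
      corners = u ∷ v ∷ w ∷ x ∷ []
      others = filter (_∉? corners) (allFin n)
      corners-unique : Unique corners
      corners-unique = (u≢v ∷ u≢w ∷ u≢x ∷ []) ∷ (v≢w ∷ v≢x ∷ []) ∷ (w≢x ∷ []) ∷ [] ∷ []
      joined : ∀ p q → J p q p q ≡ 1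
      joined p q = iverson-yes (inj₁ (refl , refl)) (joins? p q p q)
      uv-linked : 1 ≤ cycleWeight (J u v) u (v ∷ w ∷ x ∷ others)
      uv-linked = begin
        1                                           ≡⟨ joined u v ⟨
        J u v u v                                   ≤⟨ m≤m+n _ (pathWeight (J u v) v (w ∷ x ∷ others)) ⟩
        pathWeight (J u v) u (v ∷ w ∷ x ∷ others)   ≤⟨ m≤m+n _ (J u v (last x others) u) ⟩
        cycleWeight (J u v) u (v ∷ w ∷ x ∷ others)  ∎
      wx-linked : 1 ≤ cycleWeight (J w x) u (v ∷ w ∷ x ∷ others)
      wx-linked = begin
        1                                           ≡⟨ joined w x ⟨
        J w x w x                                   ≤⟨ m≤m+n _ (pathWeight (J w x) x others) ⟩
        pathWeight (J w x) w (x ∷ others)           ≤⟨ m≤n+m _ (J w x v w) ⟩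
        pathWeight (J w x) v (w ∷ x ∷ others)       ≤⟨ m≤n+m _ (J w x u v) ⟩
        pathWeight (J w x) u (v ∷ w ∷ x ∷ others)   ≤⟨ m≤m+n _ (J w x (last x others) u) ⟩
        cycleWeight (J w x) u (v ∷ w ∷ x ∷ others)  ∎

  linkedInG : ∀ a r → pathWeight defect a r ≡ 0 → u ∉ a ∷ r ⊎ v ∉ a ∷ r → w ∉ a ∷ r ⊎ x ∉ a ∷ r →
              Linked (Adj G) (a ∷ r)
  linkedInG a r no-defect avoids-uv avoids-wx =
    Linked.zipWith edge
      ( pathWeight-zero⇒Linked defect a r no-defect
      , Linked.zipWith id ( pathWeight-zero⇒Linked (J u v) a r (pathWeight-J-absent u v a r avoids-uv)
                          , pathWeight-zero⇒Linked (J w x) a r (pathWeight-J-absent w x a r avoids-wx)))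
    where
      edge : ∀ {p q} → defect p q ≡ 0 × J u v p q ≡ 0 × J w x p q ≡ 0 → Adj G p q
      edge {p} {q} (no-defect , not-uv , not-wx) with iverson-¬-zero (p ~? q) no-defect
      ... | inj₁ p-q = p-q
      ... | inj₂ (inj₁ j) with () ← trans (sym (iverson-yes j (joins? u v p q))) not-uv
      ... | inj₂ (inj₂ j) with () ← trans (sym (iverson-yes j (joins? w x p q))) not-wx

  SpanningPaths : Set
  SpanningPaths = ∃ λ (P : List (Fin n)) → ∃ λ (Q : List (Fin n)) →
    IsABPath G u v w x P × IsABPath G u v w x Q × Disjoint P Q × (∀ (y : Fin n) → y ∈ P ⊎ y ∈ Q)

  module _ (u≢w : u ≢ w) (u≢x : u ≢ x) (v≢w : v ≢ w) (v≢x : v ≢ x) where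

    apart : ∀ {a b} → a ≡ u ⊎ a ≡ v → b ≡ w ⊎ b ≡ x → a ≢ b
    apart (inj₁ refl) (inj₁ refl) = u≢w
    apart (inj₁ refl) (inj₂ refl) = u≢x
    apart (inj₂ refl) (inj₁ refl) = v≢w
    apart (inj₂ refl) (inj₂ refl) = v≢x

    abPath : ∀ a r → Unique (a ∷ r) → Linked (Adj G) (a ∷ r) →
             a ≡ u ⊎ a ≡ v → last a r ≡ w ⊎ last a r ≡ x → IsABPath G u v w x (a ∷ r)
    abPath a r U L start end = (U , L) , a , last a r , start , end , ends a r (apart start end)

    wx-link-inside : (α : Tour) → final α ≡ v → 1 ≤ pathWeight (J w x) (head α) (tail α)
    wx-link-inside (tour h t _ _ wx) final≡v =
      subst (1 ≤_) (trans (cong (pathWeight (J w x) h t +_) (iverson-no ¬joins (joins? w x (last h t) h)))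
                          (+-identityʳ _)) wx
      where
        ¬joins : ¬ Joins w x (last h t) h
        ¬joins j = apart (inj₂ final≡v) (Joins-source j) refl

    spanningPaths : (α : Tour) → defects α ≡ 0 → head α ≡ u → final α ≡ v → SpanningPaths
    spanningPaths α@(tour _ t _ _ _) perfect refl final≡v
      with pathWeight-split (J w x) u t (wx-link-inside α final≡v)
    ... | r , b , s , refl , link with reverse-∷ b s
    ...   | r′ , reversed , last≡b =
      u ∷ r , last b s ∷ r′ ,
      abPath u r U-P L-P (inj₁ refl) (Joins-source j) ,
      abPath (last b s) r′ U-Q L-Q (inj₂ l≡v)
        (subst (λ y → y ≡ w ⊎ y ≡ x) (sym last≡b) (Joins-source (Joins-sym j))) ,
      (λ y∈P y∈Q → separated y∈P (from-Q y∈Q)) ,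
      covered
      where
        j : Joins w x (last u r) b
        j = iverson-sound (joins? w x (last u r) b) link
        l≡v : last b s ≡ v
        l≡v = trans (sym (last-++ u r b s)) final≡v
        split = Unique-++⁻ (u ∷ r) (Unique-tour α)
        U-P = proj₁ split
        separated = proj₂ (proj₂ split)
        U-Q : Unique (last b s ∷ r′)
        U-Q = subst Unique reversed (Unique-resp-↭ (↭-sym (↭-reverse (b ∷ s))) (proj₁ (proj₂ split)))
        from-Q : ∀ {y} → y ∈ last b s ∷ r′ → y ∈ b ∷ s
        from-Q {y} y∈ = ∈-resp-↭ (↭-reverse (b ∷ s)) (subst (y ∈_) (sym reversed) y∈)
        to-Q : ∀ {y} → y ∈ b ∷ s → y ∈ last b s ∷ r′
        to-Q {y} y∈ = subst (y ∈_) reversed (∈-resp-↭ (↭-sym (↭-reverse (b ∷ s))) y∈)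
        no-defects = pathWeight-++-zero defect u r b s (m+n≡0⇒m≡0 _ perfect)
        L-P = linkedInG u r (proj₁ no-defects)
               (inj₂ (λ v∈ → separated v∈ (subst (_∈ b ∷ s) l≡v (last-∈ b s))))
               (Joins-∉ (Joins-sym j) (λ b∈ → separated b∈ (here refl)))
        L-Q = linkedInG (last b s) r′
               (trans (pathWeight-reverse defect-undirected b s reversed) (proj₂ no-defects))
               (inj₁ (λ u∈ → separated (here refl) (from-Q u∈)))
               (Joins-∉ j (λ a∈ → separated (last-∈ u r) (from-Q a∈)))
        covered : ∀ y → y ∈ u ∷ r ⊎ y ∈ last b s ∷ r′
        covered y = Sum.map₂ to-Q (∈-++⁻ (u ∷ r) (∈-tour α y))

-- n ≥ 4 is implied by the distinctness of u, v, w, x.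
lemma5p2 : (n : ℕ) → 4 ≤ n → (G : Graph n) →
    (∀ v → n + 2 ≤ 2 * degree G v) →
    (u v w x : Fin n) → u ≢ v → w ≢ x →
    u ≢ w → u ≢ x → v ≢ w → v ≢ x →
    ∃ λ (P : List (Fin n)) → ∃ λ (Q : List (Fin n)) →
    IsABPath G u v w x P × IsABPath G u v w x Q × Disjoint P Q ×
    (∀ (y : Fin n) → y ∈ P ⊎ y ∈ Q)
lemma5p2 n _ G δ u v w x u≢v w≢x u≢w u≢x v≢w v≢x =
  let open Tours G u v w x
      α , perfect = perfectTour δ (initialTour u≢v w≢x u≢w u≢x v≢w v≢x)
      β , same , head≡u , final≡v = orient α
  in spanningPaths u≢w u≢x v≢w v≢x β (trans same perfect) head≡u final≡v
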